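{- Let $n,t,g_0,\ell_0$ be positive integers and let $c$ be a positive integer dividing $n$. Assume there exist $0<\varepsilon<1$ and $0<k\le n$ such that for any function $f:(\{0,1\}^n)^{\ell_0}\to\{0,1\}^t$ there exists a uniform $(g_0,\ell_0)$-SHELA source $\mathbf{X}$ over $(\{0,1\}^n)^{\ell_0}$ with $H_\infty^\varepsilon(f(\mathbf{X}))<k$. Then for any function $f:(\{0,1\}^{n/c})^{c\ell_0}\to\{0,1\}^t$ there exists a uniform $(cg_0,c\ell_0)$-SHELA source $\mathbf{X}$ over $(\{0,1\}^{n/c})^{c\ell_0}$ with $H_\infty^\varepsilon(f(\mathbf{X}))<k$.
   Context: A uniform $(g,\ell)$-SHELA source over $(\{0,1\}^m)^\ell$ is a random variable $\mathbf{X}=(\mathbf{X}_1,\dots,\mathbf{X}_\ell)$, each $\mathbf{X}_i$ taking values in $\{0,1\}^m$, for which there is a set $G\subseteq[\ell]$ of at least $g$ indices ("good blocks") such that the blocks $\mathbf{X}_i$, $i\in G$, are mutually independent and each uniformly distributed on $\{0,1\}^m$, while every other block $\mathbf{X}_j$, $j\notin G$, is an arbitrary function of the preceding blocks $\mathbf{X}_1,\dots,\mathbf{X}_{j-1}$ only. For a random variable $\mathbf{Z}$, $H_\infty^\varepsilon(\mathbf{Z})=\max\{H_\infty(\mathbf{Z}') : \mathbf{Z}'\text{ is within statistical distance }\varepsilon\text{ of }\mathbf{Z}\}$, where $H_\infty(\mathbf{Z}')=-\log_2\max_z\Pr[\mathbf{Z}'=z]$.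
   Formalization: The parameters ε and k are rational, and the random variables $\mathbf{Z}'$ in the definition of $H_\infty^\varepsilon$ have rational probabilities. -}

module Defs where

open import Data.Bool using (Bool; true; false)
import Data.Bool as B
open import Data.Nat as ℕ using (ℕ; zero; suc)
open import Data.Integer as ℤ using (ℤ)
open import Data.Rational as ℚ using (ℚ; 0ℚ; 1ℚ; ½; _+_; _*_; _-_; ∣_∣; _≤_; _<_; ↥_; ↧ₙ_)
open import Data.List as L using (List; []; _∷_; concatMap; map; foldr; length; filter)
open import Data.Vec as V using (Vec; _∷ʳ_)
open import Data.Vec.Properties using (≡-dec)
open import Data.Product using (∃)
open import Relation.Binary.PropositionalEquality using (_≡_)
open import Relation.Nullary.Decidable using (Dec)

Bits : ℕ → Set
Bits m = Vec Bool m

_≟ᵇ_ : ∀ {m} (x y : Bits m) → Dec (x ≡ y)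
_≟ᵇ_ = ≡-dec B._≟_

allBits : (m : ℕ) → List (Bits m)
allBits zero = V.[] ∷ []
allBits (suc m) = concatMap (λ v → (false V.∷ v) ∷ (true V.∷ v) ∷ []) (allBits m)

-- A uniform SHELA source with ℓ blocks of m bits, described block by block
-- from left to right: each new (last) block is either a good block
-- (uniform, independent of everything else) or a bad block, given by an
-- arbitrary function of the preceding blocks.
data SHELA (m : ℕ) : ℕ → Set where
  []   : SHELA m 0
  good : ∀ {ℓ} → SHELA m ℓ → SHELA m (suc ℓ)
  bad  : ∀ {ℓ} → SHELA m ℓ → (Vec (Bits m) ℓ → Bits m) → SHELA m (suc ℓ)

numGood : ∀ {m ℓ} → SHELA m ℓ → ℕ
numGood []        = 0
numGood (good s)  = suc (numGood s)
numGood (bad s _) = numGood s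

record UniformSHELA (g ℓ m : ℕ) : Set where
  field
    source   : SHELA m ℓ
    enoughGood : g ℕ.≤ numGood source

-- The outcomes of the source, one for each assignment of values to the
-- good blocks; the source is uniformly distributed over this list
-- (of length 2^(m·|G|)), counted with multiplicity.
outcomes : ∀ {m ℓ} → SHELA m ℓ → List (Vec (Bits m) ℓ)
outcomes {m} []   = V.[] ∷ []
outcomes {m} (good s)  = concatMap (λ xs → map (λ b → xs ∷ʳ b) (allBits m)) (outcomes s)
outcomes {m} (bad s h) = map (λ xs → xs ∷ʳ h xs) (outcomes s)

pushPr : ∀ {m ℓ t} → SHELA m ℓ → (Vec (Bits m) ℓ → Bits t) → Bits t → ℚ
pushPr s f z =
  (ℤ.+ length (filter (λ xs → f xs ≟ᵇ z) (outcomes s)))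
    ℚ./ (ℕ.suc (ℕ.pred (length (outcomes s))))
-- (length (outcomes s) = 2^(m·|G|) ≥ 1, so suc ∘ pred is the identity here)

Σbits : (t : ℕ) → (Bits t → ℚ) → ℚ
Σbits t p = foldr (λ z acc → p z + acc) 0ℚ (allBits t)

record Dist (t : ℕ) : Set where
  field
    pr     : Bits t → ℚ
    nonneg : ∀ z → 0ℚ ≤ pr z
    total  : Σbits t pr ≡ 1ℚ
open Dist public

SD : (t : ℕ) → (Bits t → ℚ) → (Bits t → ℚ) → ℚ
SD t p q = ½ * Σbits t (λ z → ∣ p z - q z ∣)

powℚ : ℚ → ℕ → ℚ
powℚ x zero = 1ℚ
powℚ x (suc n) = x * powℚ x n

-- H∞(q) < k, for k > 0 rational, i.e. max_z q(z) > 2^(-k).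
-- Writing k = a/r (a = numerator, r = denominator > 0), q(z) > 2^(-a/r)
-- iff q(z)^r · 2^a > 1 (for q(z) ≥ 0, a ≥ 0).
MinEntropy<  : ∀ {t} → Dist t → ℚ → Set
MinEntropy< {t} q k =
  ∃ λ (z : Bits t) →
    1ℚ < powℚ (pr q z) (↧ₙ k) * (ℤ.+ (2 ℕ.^ ℤ.∣ ↥ k ∣) ℚ./ 1)

-- H∞^ε(P) < k : every distribution within statistical distance ε of P
-- has min-entropy < k (the max in the definition of H∞^ε is attained).
SmoothMinEntropy< : (t : ℕ) → (Bits t → ℚ) → (ε k : ℚ) → Set
SmoothMinEntropy< t p ε k =
  (q : Dist t) → SD t p (pr q) ≤ ε → MinEntropy< q k

{-# OPTIONS --safe #-}
-- Cut every block of c·d bits into c blocks of d bits.  A good block becomes c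
-- good blocks, because a uniform string of c·d bits is a uniform c-tuple of
-- d-bit strings; a bad block becomes c bad blocks, because the small blocks
-- preceding it determine the big blocks preceding it.  The refined source X′ of
-- a source X is distributed as split(X), so f(X′) and (f ∘ split)(X) have the
-- same distribution: a source that defeats f ∘ split refines to one that
-- defeats f.
module Submission where

open import Defs
open import Data.Nat using (ℕ; _<_; _/_; _*_; NonZero)
open import Data.Nat.Divisibility using (_∣_)
open import Data.Rational using (ℚ; 0ℚ; 1ℚ; _≤_) renaming (_<_ to _<ℚ_)
open import Data.Integer using (+_)
open import Data.Vec using (Vec)
open import Data.Product using (Σ)

open import Data.Bool using (true; false)
open import Data.List using (List; []; _∷_; concatMap; map; length; filter)
open import Data.List.Properties
  using (concatMap-++; concatMap-cong; concatMap-map; concatMap-pure; map-concatMap;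
         map-cong; map-∘; map-id; length-map; foldr-cong)
open import Data.Nat using (zero; suc; _+_; pred) renaming (_≤_ to _≤ℕ_)
open import Data.Nat.DivMod using (m*[n/m]≡n)
open import Data.Nat.Properties using (*-comm; *-monoˡ-≤)
open import Data.Product using (_×_; _,_; proj₁; proj₂)
import Data.Product as Product
import Data.Rational as ℚ
open import Data.Vec using (_++_; _∷ʳ_; init; last; initLast; take; drop)
import Data.Vec as Vec
open import Data.Vec.Properties using (init-∷ʳ; last-∷ʳ; take++drop≡id; ++-injective)
open import Function using (_∘_)
open import Level using (0ℓ)
open import Relation.Binary.PropositionalEquality
open import Relation.Nullary using (does)
open import Relation.Unary using (Pred; Decidable)

private
  variable
    A B C : Set
    d j k m n ℓ t : ℕ

concatMap-concatMap : (f : A → List B) (g : B → List C) (xs : List A) →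
  concatMap g (concatMap f xs) ≡ concatMap (concatMap g ∘ f) xs
concatMap-concatMap f g []       = refl
concatMap-concatMap f g (x ∷ xs) =
  trans (concatMap-++ g (f x) (concatMap f xs)) (cong (_ Data.List.++_) (concatMap-concatMap f g xs))

filter-map : {P : Pred B 0ℓ} (P? : Decidable P) (g : A → B) (xs : List A) →
  filter P? (map g xs) ≡ map g (filter (P? ∘ g) xs)
filter-map P? g []       = refl
filter-map P? g (x ∷ xs) with does (P? (g x))
... | false = filter-map P? g xs
... | true  = cong (g x ∷_) (filter-map P? g xs)

init-∷ʳ-last : (w : Vec A (suc n)) → init w ∷ʳ last w ≡ w
init-∷ʳ-last w = sym (proj₂ (proj₂ (initLast w)))

take-drop-++ : (u : Vec A m) (w : Vec A n) → take m (u ++ w) ≡ u × drop m (u ++ w) ≡ w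
take-drop-++ {m = m} u w = ++-injective (take m (u ++ w)) u (take++drop≡id m (u ++ w))

-- The length is j + k, not k + j, so that each further block of w adds a `suc`
-- on the left, as the constructors of SHELA do.
append : Vec A k → Vec A j → Vec A (j + k)
append {j = zero}  v w = v
append {j = suc j} v w = append v (init w) ∷ʳ last w

unappend : ∀ j → Vec A (j + k) → Vec A k × Vec A j
unappend zero    u = u , Vec.[]
unappend (suc j) u = Product.map₂ (_∷ʳ last u) (unappend j (init u))

append-∷ʳ : (v : Vec A k) (w : Vec A j) (x : A) → append v (w ∷ʳ x) ≡ append v w ∷ʳ x
append-∷ʳ v w x rewrite init-∷ʳ x w | last-∷ʳ x w = refl

unappend-append : ∀ j (v : Vec A k) (w : Vec A j) → unappend j (append v w) ≡ (v , w)
unappend-append zero    v Vec.[] = refl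
unappend-append (suc j) v w
  rewrite init-∷ʳ (last w) (append v (init w)) | last-∷ʳ (last w) (append v (init w))
        | unappend-append j v (init w) = cong (v ,_) (init-∷ʳ-last w)

-- The first d entries of u become the last chunk, matching the enumeration
-- orders of `allBits` and `outcomes` (see `map-chunks-allBits`).
chunks : ∀ c → Vec A (c * d) → Vec (Vec A d) c
chunks zero    u = Vec.[]
chunks {d = d} (suc c) u = chunks c (drop d u) ∷ʳ take d u

unchunks : ∀ c → Vec (Vec A d) c → Vec A (c * d)
unchunks zero    ws = Vec.[]
unchunks (suc c) ws = last ws ++ unchunks c (init ws)

chunks-++ : ∀ c (u : Vec A d) (w : Vec A (c * d)) → chunks (suc c) (u ++ w) ≡ chunks c w ∷ʳ u
chunks-++ c u w with take-drop-++ u w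
... | take≡u , drop≡w rewrite take≡u | drop≡w = refl

unchunks-chunks : ∀ c (u : Vec A (c * d)) → unchunks c (chunks c u) ≡ u
unchunks-chunks zero    Vec.[] = refl
unchunks-chunks {d = d} (suc c) u
  rewrite init-∷ʳ (take d u) (chunks c (drop d u)) | last-∷ʳ (take d u) (chunks c (drop d u))
        | unchunks-chunks c (drop d u) = take++drop≡id d u

allBits-++ : ∀ m n → allBits (m + n) ≡ concatMap (λ w → map (_++ w) (allBits m)) (allBits n)
allBits-++ zero    n = sym (concatMap-pure (allBits n))
allBits-++ (suc m) n = begin
  concatMap extend (allBits (m + n))
    ≡⟨ cong (concatMap extend) (allBits-++ m n) ⟩
  concatMap extend (concatMap (λ w → map (_++ w) (allBits m)) (allBits n))
    ≡⟨ concatMap-concatMap _ extend (allBits n) ⟩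
  concatMap (λ w → concatMap extend (map (_++ w) (allBits m))) (allBits n)
    ≡⟨ concatMap-cong (λ w → trans (concatMap-map extend (_++ w) (allBits m))
                                   (sym (map-concatMap (_++ w) extend (allBits m)))) (allBits n) ⟩
  concatMap (λ w → map (_++ w) (concatMap extend (allBits m))) (allBits n) ∎
  where
  open ≡-Reasoning
  extend : Bits j → List (Bits (suc j))
  extend v = (false Vec.∷ v) ∷ (true Vec.∷ v) ∷ []

allGood : ∀ j → SHELA m j
allGood zero    = []
allGood (suc j) = good (allGood j)

appendGood : ∀ j → SHELA m k → SHELA m (j + k)
appendGood zero    s = s
appendGood (suc j) s = good (appendGood j s)

appendBad : ∀ j → SHELA m k → (Vec (Bits m) k → Vec (Bits m) j) → SHELA m (j + k)
appendBad zero    s g = s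
appendBad (suc j) s g = bad (appendBad j s (init ∘ g)) (λ u → last (g (proj₁ (unappend j u))))

numGood-appendGood : ∀ j (s : SHELA m k) → numGood (appendGood j s) ≡ j + numGood s
numGood-appendGood zero    s = refl
numGood-appendGood (suc j) s = cong suc (numGood-appendGood j s)

numGood-appendBad : ∀ j (s : SHELA m k) g → numGood (appendBad j s g) ≡ numGood s
numGood-appendBad zero    s g = refl
numGood-appendBad (suc j) s g = numGood-appendBad j s (init ∘ g)

outcomes-appendGood : ∀ j (s : SHELA m k) →
  outcomes (appendGood j s) ≡ concatMap (λ v → map (append v) (outcomes (allGood {m} j))) (outcomes s)
outcomes-appendGood zero    s = sym (concatMap-pure (outcomes s))
outcomes-appendGood {m = m} (suc j) s = begin
  concatMap extend (outcomes (appendGood j s))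
    ≡⟨ cong (concatMap extend) (outcomes-appendGood j s) ⟩
  concatMap extend (concatMap (λ v → map (append v) (outcomes (allGood j))) (outcomes s))
    ≡⟨ concatMap-concatMap _ extend (outcomes s) ⟩
  concatMap (λ v → concatMap extend (map (append v) (outcomes (allGood j)))) (outcomes s)
    ≡⟨ concatMap-cong extend-append (outcomes s) ⟩
  concatMap (λ v → map (append v) (concatMap extend (outcomes (allGood j)))) (outcomes s) ∎
  where
  open ≡-Reasoning
  extend : Vec (Bits m) n → List (Vec (Bits m) (suc n))
  extend u = map (u ∷ʳ_) (allBits m)
  extend-append : (v : Vec (Bits m) k) →
    concatMap extend (map (append v) (outcomes (allGood j))) ≡
    map (append v) (concatMap extend (outcomes (allGood j)))
  extend-append v = begin
    concatMap extend (map (append v) (outcomes (allGood j)))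
      ≡⟨ concatMap-map extend (append v) (outcomes (allGood j)) ⟩
    concatMap (λ w → map (append v w ∷ʳ_) (allBits m)) (outcomes (allGood j))
      ≡⟨ concatMap-cong (λ w → trans (map-cong (λ x → sym (append-∷ʳ v w x)) (allBits m))
                                     (map-∘ {g = append v} {f = w ∷ʳ_} (allBits m)))
                        (outcomes (allGood j)) ⟩
    concatMap (map (append v) ∘ extend) (outcomes (allGood j))
      ≡⟨ map-concatMap (append v) extend (outcomes (allGood j)) ⟨
    map (append v) (concatMap extend (outcomes (allGood j))) ∎

outcomes-appendBad : ∀ j (s : SHELA m k) g →
  outcomes (appendBad j s g) ≡ map (λ v → append v (g v)) (outcomes s)
outcomes-appendBad zero    s g = sym (map-id (outcomes s))
outcomes-appendBad (suc j) s g = begin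
  map (λ u → u ∷ʳ last (g (proj₁ (unappend j u)))) (outcomes (appendBad j s (init ∘ g)))
    ≡⟨ cong (map _) (outcomes-appendBad j s (init ∘ g)) ⟩
  map (λ u → u ∷ʳ last (g (proj₁ (unappend j u)))) (map (λ v → append v (init (g v))) (outcomes s))
    ≡⟨ map-∘ (outcomes s) ⟨
  map (λ v → append v (init (g v)) ∷ʳ last (g (proj₁ (unappend j (append v (init (g v)))))))
      (outcomes s)
    ≡⟨ map-cong (λ v → cong (λ u → append v (init (g v)) ∷ʳ last (g (proj₁ u)))
                            (unappend-append j v (init (g v)))) (outcomes s) ⟩
  map (λ v → append v (g v)) (outcomes s) ∎
  where open ≡-Reasoning

map-chunks-allBits : ∀ c → map (chunks c) (allBits (c * d)) ≡ outcomes (allGood {d} c)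
map-chunks-allBits zero = refl
map-chunks-allBits {d = d} (suc c) = begin
  map (chunks (suc c)) (allBits (d + c * d))
    ≡⟨ cong (map (chunks (suc c))) (allBits-++ d (c * d)) ⟩
  map (chunks (suc c)) (concatMap (λ w → map (_++ w) (allBits d)) (allBits (c * d)))
    ≡⟨ map-concatMap (chunks (suc c)) _ (allBits (c * d)) ⟩
  concatMap (λ w → map (chunks (suc c)) (map (_++ w) (allBits d))) (allBits (c * d))
    ≡⟨ concatMap-cong (λ w → trans (sym (map-∘ {g = chunks (suc c)} {f = _++ w} (allBits d)))
                                   (map-cong (λ u → chunks-++ c u w) (allBits d))) (allBits (c * d)) ⟩
  concatMap (λ w → map (chunks c w ∷ʳ_) (allBits d)) (allBits (c * d))
    ≡⟨ concatMap-map (λ ws → map (ws ∷ʳ_) (allBits d)) (chunks c) (allBits (c * d)) ⟨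
  concatMap (λ ws → map (ws ∷ʳ_) (allBits d)) (map (chunks c) (allBits (c * d)))
    ≡⟨ cong (concatMap _) (map-chunks-allBits c) ⟩
  outcomes (allGood (suc c)) ∎
  where open ≡-Reasoning

module _ (c : ℕ) {d : ℕ} where

  split : Vec (Bits (c * d)) ℓ → Vec (Bits d) (ℓ * c)
  split {zero}  xs = Vec.[]
  split {suc ℓ} xs = append (split (init xs)) (chunks c (last xs))

  merge : Vec (Bits d) (ℓ * c) → Vec (Bits (c * d)) ℓ
  merge {zero}  u = Vec.[]
  merge {suc ℓ} u = merge (proj₁ (unappend c u)) ∷ʳ unchunks c (proj₂ (unappend c u))

  split-∷ʳ : (xs : Vec (Bits (c * d)) ℓ) (x : Bits (c * d)) →
    split (xs ∷ʳ x) ≡ append (split xs) (chunks c x)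
  split-∷ʳ xs x rewrite init-∷ʳ x xs | last-∷ʳ x xs = refl

  merge-split : (xs : Vec (Bits (c * d)) ℓ) → merge (split xs) ≡ xs
  merge-split {zero}  Vec.[] = refl
  merge-split {suc ℓ} xs
    rewrite unappend-append c (split (init xs)) (chunks c (last xs))
          | merge-split (init xs) | unchunks-chunks c (last xs) = init-∷ʳ-last xs

  refine : SHELA (c * d) ℓ → SHELA d (ℓ * c)
  refine []        = []
  refine (good s)  = appendGood c (refine s)
  refine (bad s h) = appendBad c (refine s) (chunks c ∘ h ∘ merge)

  numGood-refine : (s : SHELA (c * d) ℓ) → numGood (refine s) ≡ numGood s * c
  numGood-refine []        = refl
  numGood-refine (good s)  = trans (numGood-appendGood c (refine s)) (cong (λ g → c + g) (numGood-refine s))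
  numGood-refine (bad s h) = trans (numGood-appendBad c (refine s) _) (numGood-refine s)

  outcomes-refine : (s : SHELA (c * d) ℓ) → outcomes (refine s) ≡ map split (outcomes s)
  outcomes-refine []        = refl
  outcomes-refine (good s) = begin
    outcomes (appendGood c (refine s))
      ≡⟨ outcomes-appendGood c (refine s) ⟩
    concatMap (λ v → map (append v) (outcomes (allGood c))) (outcomes (refine s))
      ≡⟨ cong (concatMap _) (outcomes-refine s) ⟩
    concatMap (λ v → map (append v) (outcomes (allGood c))) (map split (outcomes s))
      ≡⟨ concatMap-map _ split (outcomes s) ⟩
    concatMap (λ xs → map (append (split xs)) (outcomes (allGood c))) (outcomes s)
      ≡⟨ concatMap-cong split-good (outcomes s) ⟩
    concatMap (λ xs → map split (map (xs ∷ʳ_) (allBits (c * d)))) (outcomes s)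
      ≡⟨ map-concatMap split _ (outcomes s) ⟨
    map split (outcomes (good s)) ∎
    where
    open ≡-Reasoning
    split-good : (xs : Vec (Bits (c * d)) ℓ) →
      map (append (split xs)) (outcomes (allGood c)) ≡ map split (map (xs ∷ʳ_) (allBits (c * d)))
    split-good xs = begin
      map (append (split xs)) (outcomes (allGood c))
        ≡⟨ cong (map (append (split xs))) (map-chunks-allBits c) ⟨
      map (append (split xs)) (map (chunks c) (allBits (c * d)))
        ≡⟨ map-∘ (allBits (c * d)) ⟨
      map (λ x → append (split xs) (chunks c x)) (allBits (c * d))
        ≡⟨ map-cong (λ x → sym (split-∷ʳ xs x)) (allBits (c * d)) ⟩
      map (λ x → split (xs ∷ʳ x)) (allBits (c * d))
        ≡⟨ map-∘ (allBits (c * d)) ⟩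
      map split (map (xs ∷ʳ_) (allBits (c * d))) ∎
  outcomes-refine (bad s h) = begin
    outcomes (appendBad c (refine s) (chunks c ∘ h ∘ merge))
      ≡⟨ outcomes-appendBad c (refine s) _ ⟩
    map (λ v → append v (chunks c (h (merge v)))) (outcomes (refine s))
      ≡⟨ cong (map _) (outcomes-refine s) ⟩
    map (λ v → append v (chunks c (h (merge v)))) (map split (outcomes s))
      ≡⟨ map-∘ (outcomes s) ⟨
    map (λ xs → append (split xs) (chunks c (h (merge (split xs))))) (outcomes s)
      ≡⟨ map-cong (λ xs → trans (cong (λ ys → append (split xs) (chunks c (h ys))) (merge-split xs))
                                (sym (split-∷ʳ xs (h xs)))) (outcomes s) ⟩
    map (λ xs → split (xs ∷ʳ h xs)) (outcomes s)
      ≡⟨ map-∘ (outcomes s) ⟩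
    map split (outcomes (bad s h)) ∎
    where open ≡-Reasoning

pushPr-outcomes-map : (s : SHELA m ℓ) (s′ : SHELA n k) (φ : Vec (Bits m) ℓ → Vec (Bits n) k) →
  outcomes s′ ≡ map φ (outcomes s) →
  (f : Vec (Bits n) k → Bits t) → pushPr s′ f ≗ pushPr s (f ∘ φ)
pushPr-outcomes-map s s′ φ eq f z rewrite eq =
  cong₂ (λ a b → (+ a) ℚ./ suc (pred b))
    (trans (cong length (filter-map (λ ys → f ys ≟ᵇ z) φ (outcomes s)))
           (length-map φ (filter (λ xs → f (φ xs) ≟ᵇ z) (outcomes s))))
    (length-map φ (outcomes s))

smoothMinEntropy<-cong : {p q : Bits t → ℚ} {ε k : ℚ} → p ≗ q →
  SmoothMinEntropy< t p ε k → SmoothMinEntropy< t q ε k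
smoothMinEntropy<-cong {t} {p} {q} {ε} p≗q H r qr≤ε = H r (subst (ℚ._≤ ε) SD-q≡SD-p qr≤ε)
  where
  SD-q≡SD-p : SD t q (pr r) ≡ SD t p (pr r)
  SD-q≡SD-p = cong (ℚ.½ ℚ.*_)
    (foldr-cong (λ z acc → cong (λ a → ℚ.∣ a ℚ.- pr r z ∣ ℚ.+ acc) (sym (p≗q z))) refl (allBits t))

NoSHELACondenser : (g ℓ m t : ℕ) (ε k : ℚ) → Set
NoSHELACondenser g ℓ m t ε k =
  (f : Vec (Bits m) ℓ → Bits t) →
    Σ (UniformSHELA g ℓ m) λ X → SmoothMinEntropy< t (pushPr (UniformSHELA.source X) f) ε k

refineUniform : ∀ c {g} → UniformSHELA g ℓ (c * d) → UniformSHELA (g * c) (ℓ * c) d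
refineUniform c {g} X = record
  { source     = refine c source
  ; enoughGood = subst (g * c ≤ℕ_) (sym (numGood-refine c source)) (*-monoˡ-≤ c enoughGood)
  }
  where open UniformSHELA X

noSHELACondenser-refine : ∀ c {g ε k} →
  NoSHELACondenser g ℓ (c * d) t ε k → NoSHELACondenser (g * c) (ℓ * c) d t ε k
noSHELACondenser-refine c {ε = ε} {k} H f with H (f ∘ split c)
... | X , f∘split-defeated =
  refineUniform c X ,
  smoothMinEntropy<-cong {ε = ε} {k}
    (λ z → sym (pushPr-outcomes-map source (refine c source) (split c)
                                    (outcomes-refine c source) f z))
    f∘split-defeated
  where open UniformSHELA X

mainTheorem8 : (n t g₀ ℓ₀ c : ℕ) → 0 < n → 0 < t → 0 < g₀ → 0 < ℓ₀
    → .{{_ : NonZero c}} → c ∣ n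
    → (ε k : ℚ) → 0ℚ <ℚ ε → ε <ℚ 1ℚ → 0ℚ <ℚ k → k ≤ (+ n Data.Rational./ 1)
    → ((f : Vec (Bits n) ℓ₀ → Bits t) →
        Σ (UniformSHELA g₀ ℓ₀ n) λ X →
          SmoothMinEntropy< t (pushPr (UniformSHELA.source X) f) ε k)
    → ((f : Vec (Bits (n / c)) (c * ℓ₀) → Bits t) →
        Σ (UniformSHELA (c * g₀) (c * ℓ₀) (n / c)) λ X →
          SmoothMinEntropy< t (pushPr (UniformSHELA.source X) f) ε k)
mainTheorem8 n t g₀ ℓ₀ c _ _ _ _ c∣n ε k _ _ _ _ =
    subst₂ (λ g ℓ → NoSHELACondenser g ℓ (n / c) t ε k) (*-comm g₀ c) (*-comm ℓ₀ c)
  ∘ noSHELACondenser-refine c {g₀} {ε} {k}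
  ∘ subst (λ m → NoSHELACondenser g₀ ℓ₀ m t ε k) (sym (m*[n/m]≡n c∣n))
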